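{- For every formula $\alpha\in Fm$, either $\alpha$ is $\mathbf{Six}$-equivalent to $\top$, or to $\bot$, or $\alpha$ is $\mathbf{Six}$-equivalent to a formula $\bigwedge_{i=1}^{n}\bigvee_{j=1}^{m_i}\alpha_{ij}$ ($n\ge0$, $m_i\ge0$) where each $\alpha_{ij}\in\{p_k,\neg p_k,\nabla p_k,\nabla\neg p_k,\neg\nabla p_k,\neg\nabla\neg p_k\}$ for some propositional variable $p_k$. Here $\beta$ and $\gamma$ are $\mathbf{Six}$-equivalent when $\beta\models_{\mathbf{Six}}\gamma$ and $\gamma\models_{\mathbf{Six}}\beta$.
   Context: An involutive Stone algebra is a De Morgan algebra (bounded distributive lattice with $\neg\neg x=x$, $\neg(x\wedge y)=\neg x\vee\neg y$) with a unary $\nabla$ satisfying $\nabla0=0$, $a\wedge\nabla a=a$, $\nabla(a\wedge b)=\nabla a\wedge\nabla b$, $\neg\nabla a\wedge\nabla a=0$; the class is $\mathbf S$. $Fm$ is the set of formulas over a denumerable set of propositional variables built from binary $\wedge,\vee$, unary $\neg,\nabla$ and constants $\bot,\top$; homomorphisms send $\bot\mapsto0,\top\mapsto1$. The logic $\mathbf{Six}$: $\beta\models_{\mathbf{Six}}\gamma$ iff for every $A\in\mathbf S$, every homomorphism $v:\mathfrak{Fm}\to A$ and every $a\in A$, $v(\beta)\ge a$ implies $v(\gamma)\ge a$. -}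

module Defs where

open import Data.Nat using (ℕ)
open import Data.List using (List; []; _∷_)
open import Data.Product using (_×_; _,_)
open import Relation.Binary.PropositionalEquality using (_≡_)

data Fm : Set where
  var  : ℕ → Fm
  _∧'_ : Fm → Fm → Fm
  _∨'_ : Fm → Fm → Fm
  ¬'_  : Fm → Fm
  ∇'_  : Fm → Fm
  ⊥'   : Fm
  ⊤'   : Fm

-- Involutive Stone algebras: De Morgan algebras (bounded distributive lattices
-- with an involutive De Morgan negation) with a unary ∇.
record ISAlgebra : Set₁ where
  infixr 7 _∧_
  infixr 6 _∨_
  field
    Carrier : Set
    _∧_ _∨_ : Carrier → Carrier → Carrier
    ¬_ ∇_ : Carrier → Carrier
    𝟘 𝟙 : Carrier
    ∧-assoc : ∀ x y z → (x ∧ y) ∧ z ≡ x ∧ (y ∧ z)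
    ∨-assoc : ∀ x y z → (x ∨ y) ∨ z ≡ x ∨ (y ∨ z)
    ∧-comm  : ∀ x y → x ∧ y ≡ y ∧ x
    ∨-comm  : ∀ x y → x ∨ y ≡ y ∨ x
    ∧-absorb : ∀ x y → x ∧ (x ∨ y) ≡ x
    ∨-absorb : ∀ x y → x ∨ (x ∧ y) ≡ x
    ∧-distrib-∨ : ∀ x y z → x ∧ (y ∨ z) ≡ (x ∧ y) ∨ (x ∧ z)
    ∧-identity : ∀ x → x ∧ 𝟙 ≡ x
    ∨-identity : ∀ x → x ∨ 𝟘 ≡ x
    ¬¬ : ∀ x → ¬ (¬ x) ≡ x
    deMorgan : ∀ x y → ¬ (x ∧ y) ≡ (¬ x) ∨ (¬ y)
    ∇𝟘 : ∇ 𝟘 ≡ 𝟘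
    ∇-incr : ∀ a → a ∧ (∇ a) ≡ a
    ∇-∧ : ∀ a b → ∇ (a ∧ b) ≡ (∇ a) ∧ (∇ b)
    ∇-compl : ∀ a → (¬ (∇ a)) ∧ (∇ a) ≡ 𝟘

  _≤_ : Carrier → Carrier → Set
  a ≤ b = a ∧ b ≡ a

-- Homomorphisms 𝔉𝔪 → A are determined by valuations of the variables.
module _ (A : ISAlgebra) where
  open ISAlgebra A

  ⟦_⟧ : Fm → (ℕ → Carrier) → Carrier
  ⟦ var k ⟧ v = v k
  ⟦ φ ∧' ψ ⟧ v = ⟦ φ ⟧ v ∧ ⟦ ψ ⟧ v
  ⟦ φ ∨' ψ ⟧ v = ⟦ φ ⟧ v ∨ ⟦ ψ ⟧ v
  ⟦ ¬' φ ⟧ v = ¬ (⟦ φ ⟧ v)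
  ⟦ ∇' φ ⟧ v = ∇ (⟦ φ ⟧ v)
  ⟦ ⊥' ⟧ v = 𝟘
  ⟦ ⊤' ⟧ v = 𝟙

-- Consequence in Six (degree-preserving over the class S)
_⊨Six_ : Fm → Fm → Set₁
β ⊨Six γ = (A : ISAlgebra) (v : ℕ → ISAlgebra.Carrier A) (a : ISAlgebra.Carrier A) →
  ISAlgebra._≤_ A a (⟦ A ⟧ β v) → ISAlgebra._≤_ A a (⟦ A ⟧ γ v)

_≡Six_ : Fm → Fm → Set₁
β ≡Six γ = (β ⊨Six γ) × (γ ⊨Six β)

data LitKind : Set where
  pos neg nab nabNeg negNab negNabNeg : LitKind

Literal : Set
Literal = LitKind × ℕ

litFm : Literal → Fm
litFm (pos , k) = var k
litFm (neg , k) = ¬' var k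
litFm (nab , k) = ∇' var k
litFm (nabNeg , k) = ∇' (¬' var k)
litFm (negNab , k) = ¬' (∇' var k)
litFm (negNabNeg , k) = ¬' (∇' (¬' var k))

⋁ : List Fm → Fm
⋁ [] = ⊥'
⋁ (φ ∷ []) = φ
⋁ (φ ∷ φs) = φ ∨' ⋁ φs

⋀ : List Fm → Fm
⋀ [] = ⊤'
⋀ (φ ∷ []) = φ
⋀ (φ ∷ φs) = φ ∧' ⋀ φs

CNF : Set
CNF = List (List Literal)

cnfFm : CNF → Fm
cnfFm c = ⋀ (Data.List.map (λ cl → ⋁ (Data.List.map litFm cl)) c)

{-# OPTIONS --safe #-}
module Submission where

open import Defs
open import Data.Sum using (_⊎_; inj₂)
open import Data.Product using (∃; _×_; _,_)
open import Data.Nat using (ℕ)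
open import Data.List using (List; []; _∷_; _++_; map)
open import Relation.Binary.PropositionalEquality

-- Negation and ∇ can be pushed down to the variables: ¬ is a De Morgan
-- involution, and ∇ commutes with ∧, ∨, 0, 1 and fixes ∇a and ¬∇a, because ∇x is
-- the least complemented element above x.  So every formula denotes the same
-- element, in every algebra and valuation, as a ∧/∨-combination of the six
-- literal shapes, which distributivity brings into conjunctive normal form.

module ISAlgebraProperties (A : ISAlgebra) where
  open ISAlgebra A
  open ≡-Reasoning

  ∧-identityˡ : ∀ x → 𝟙 ∧ x ≡ x
  ∧-identityˡ x = trans (∧-comm 𝟙 x) (∧-identity x)

  ∨-identityˡ : ∀ x → 𝟘 ∨ x ≡ x
  ∨-identityˡ x = trans (∨-comm 𝟘 x) (∨-identity x)

  ∨-zeroˡ : ∀ x → 𝟙 ∨ x ≡ 𝟙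
  ∨-zeroˡ x = trans (sym (∧-identityˡ _)) (∧-absorb 𝟙 x)

  ∨-zeroʳ : ∀ x → x ∨ 𝟙 ≡ 𝟙
  ∨-zeroʳ x = trans (∨-comm x 𝟙) (∨-zeroˡ x)

  ∧-zeroˡ : ∀ x → 𝟘 ∧ x ≡ 𝟘
  ∧-zeroˡ x = trans (sym (∨-identityˡ _)) (∨-absorb 𝟘 x)

  ∧-zeroʳ : ∀ x → x ∧ 𝟘 ≡ 𝟘
  ∧-zeroʳ x = trans (∧-comm x 𝟘) (∧-zeroˡ x)

  ∧-idem : ∀ x → x ∧ x ≡ x
  ∧-idem x = trans (cong (x ∧_) (sym (∨-absorb x x))) (∧-absorb x (x ∧ x))

  ∧-distribʳ-∨ : ∀ x y z → (y ∨ z) ∧ x ≡ (y ∧ x) ∨ (z ∧ x)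
  ∧-distribʳ-∨ x y z = begin
    (y ∨ z) ∧ x        ≡⟨ ∧-comm _ _ ⟩
    x ∧ (y ∨ z)        ≡⟨ ∧-distrib-∨ x y z ⟩
    (x ∧ y) ∨ (x ∧ z)  ≡⟨ cong₂ _∨_ (∧-comm x y) (∧-comm x z) ⟩
    (y ∧ x) ∨ (z ∧ x)  ∎

  ∨-distrib-∧ : ∀ x y z → x ∨ (y ∧ z) ≡ (x ∨ y) ∧ (x ∨ z)
  ∨-distrib-∧ x y z = sym (begin
    (x ∨ y) ∧ (x ∨ z)              ≡⟨ ∧-distrib-∨ (x ∨ y) x z ⟩
    ((x ∨ y) ∧ x) ∨ ((x ∨ y) ∧ z)  ≡⟨ cong₂ _∨_ (trans (∧-comm _ _) (∧-absorb x y)) (∧-distribʳ-∨ z x y) ⟩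
    x ∨ ((x ∧ z) ∨ (y ∧ z))        ≡⟨ sym (∨-assoc _ _ _) ⟩
    (x ∨ (x ∧ z)) ∨ (y ∧ z)        ≡⟨ cong (_∨ (y ∧ z)) (∨-absorb x z) ⟩
    x ∨ (y ∧ z)                    ∎)

  ¬-∨ : ∀ x y → ¬ (x ∨ y) ≡ ¬ x ∧ ¬ y
  ¬-∨ x y = begin
    ¬ (x ∨ y)              ≡⟨ cong ¬_ (cong₂ _∨_ (sym (¬¬ x)) (sym (¬¬ y))) ⟩
    ¬ (¬ (¬ x) ∨ ¬ (¬ y))  ≡⟨ cong ¬_ (sym (deMorgan (¬ x) (¬ y))) ⟩
    ¬ (¬ (¬ x ∧ ¬ y))      ≡⟨ ¬¬ _ ⟩
    ¬ x ∧ ¬ y              ∎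

  ¬𝟘 : ¬ 𝟘 ≡ 𝟙
  ¬𝟘 = begin
    ¬ 𝟘            ≡⟨ cong ¬_ (sym (∧-zeroˡ (¬ 𝟙))) ⟩
    ¬ (𝟘 ∧ ¬ 𝟙)    ≡⟨ deMorgan _ _ ⟩
    ¬ 𝟘 ∨ ¬ (¬ 𝟙)  ≡⟨ cong (¬ 𝟘 ∨_) (¬¬ 𝟙) ⟩
    ¬ 𝟘 ∨ 𝟙        ≡⟨ ∨-zeroʳ _ ⟩
    𝟙              ∎

  ¬𝟙 : ¬ 𝟙 ≡ 𝟘
  ¬𝟙 = trans (cong ¬_ (sym ¬𝟘)) (¬¬ 𝟘)

  ≤-refl : ∀ x → x ≤ x
  ≤-refl = ∧-idem

  ≤-trans : ∀ {a b c} → a ≤ b → b ≤ c → a ≤ c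
  ≤-trans {a} {b} {c} a≤b b≤c = begin
    a ∧ c        ≡⟨ cong (_∧ c) (sym a≤b) ⟩
    (a ∧ b) ∧ c  ≡⟨ ∧-assoc _ _ _ ⟩
    a ∧ (b ∧ c)  ≡⟨ cong (a ∧_) b≤c ⟩
    a ∧ b        ≡⟨ a≤b ⟩
    a            ∎

  ≤-antisym : ∀ {a b} → a ≤ b → b ≤ a → a ≡ b
  ≤-antisym {a} {b} a≤b b≤a = trans (sym a≤b) (trans (∧-comm a b) b≤a)

  x≤x∨y : ∀ x y → x ≤ (x ∨ y)
  x≤x∨y = ∧-absorb

  y≤x∨y : ∀ x y → y ≤ (x ∨ y)
  y≤x∨y x y = trans (cong (y ∧_) (∨-comm x y)) (∧-absorb y x)

  ∨-least : ∀ {x y z} → x ≤ z → y ≤ z → (x ∨ y) ≤ z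
  ∨-least {x} {y} {z} x≤z y≤z = begin
    (x ∨ y) ∧ z        ≡⟨ ∧-distribʳ-∨ z x y ⟩
    (x ∧ z) ∨ (y ∧ z)  ≡⟨ cong₂ _∨_ x≤z y≤z ⟩
    x ∨ y              ∎

  ∨-mono-≤ : ∀ {x y x′ y′} → x ≤ x′ → y ≤ y′ → (x ∨ y) ≤ (x′ ∨ y′)
  ∨-mono-≤ x≤x′ y≤y′ = ∨-least (≤-trans x≤x′ (x≤x∨y _ _)) (≤-trans y≤y′ (y≤x∨y _ _))

  ∇-mono-≤ : ∀ {a b} → a ≤ b → (∇ a) ≤ (∇ b)
  ∇-mono-≤ {a} {b} a≤b = trans (sym (∇-∧ a b)) (cong ∇_ a≤b)

  Complements : Carrier → Carrier → Set
  Complements c c′ = (c ∧ c′ ≡ 𝟘) × (c ∨ c′ ≡ 𝟙)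

  complements-sym : ∀ {c c′} → Complements c c′ → Complements c′ c
  complements-sym {c} {c′} (meet , join) = trans (∧-comm c′ c) meet , trans (∨-comm c′ c) join

  complements-∨ : ∀ {c c′ d d′} → Complements c c′ → Complements d d′ →
                  Complements (c ∨ d) (c′ ∧ d′)
  complements-∨ {c} {c′} {d} {d′} (c∧c′ , c∨c′) (d∧d′ , d∨d′) = meet , join
    where
    meet : (c ∨ d) ∧ (c′ ∧ d′) ≡ 𝟘
    meet = begin
      (c ∨ d) ∧ (c′ ∧ d′)                ≡⟨ ∧-distribʳ-∨ _ c d ⟩
      (c ∧ (c′ ∧ d′)) ∨ (d ∧ (c′ ∧ d′))  ≡⟨ cong₂ _∨_ (sym (∧-assoc c c′ d′)) (cong (d ∧_) (∧-comm c′ d′)) ⟩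
      ((c ∧ c′) ∧ d′) ∨ (d ∧ (d′ ∧ c′))  ≡⟨ cong ((c ∧ c′) ∧ d′ ∨_) (sym (∧-assoc d d′ c′)) ⟩
      ((c ∧ c′) ∧ d′) ∨ ((d ∧ d′) ∧ c′)  ≡⟨ cong₂ (λ p q → (p ∧ d′) ∨ (q ∧ c′)) c∧c′ d∧d′ ⟩
      (𝟘 ∧ d′) ∨ (𝟘 ∧ c′)                ≡⟨ cong₂ _∨_ (∧-zeroˡ d′) (∧-zeroˡ c′) ⟩
      𝟘 ∨ 𝟘                              ≡⟨ ∨-identity 𝟘 ⟩
      𝟘                                  ∎
    join : (c ∨ d) ∨ (c′ ∧ d′) ≡ 𝟙
    join = begin
      (c ∨ d) ∨ (c′ ∧ d′)                ≡⟨ ∨-distrib-∧ _ c′ d′ ⟩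
      ((c ∨ d) ∨ c′) ∧ ((c ∨ d) ∨ d′)    ≡⟨ cong₂ _∧_ (cong (_∨ c′) (∨-comm c d)) refl ⟩
      ((d ∨ c) ∨ c′) ∧ ((c ∨ d) ∨ d′)    ≡⟨ cong₂ _∧_ (∨-assoc d c c′) (∨-assoc c d d′) ⟩
      (d ∨ (c ∨ c′)) ∧ (c ∨ (d ∨ d′))    ≡⟨ cong₂ (λ p q → (d ∨ p) ∧ (c ∨ q)) c∨c′ d∨d′ ⟩
      (d ∨ 𝟙) ∧ (c ∨ 𝟙)                  ≡⟨ cong₂ _∧_ (∨-zeroʳ d) (∨-zeroʳ c) ⟩
      𝟙 ∧ 𝟙                              ≡⟨ ∧-identity 𝟙 ⟩
      𝟙                                  ∎

  ∇-complemented : ∀ a → Complements (∇ a) (¬ (∇ a))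
  ∇-complemented a = trans (∧-comm _ _) (∇-compl a) , (begin
    ∇ a ∨ ¬ (∇ a)          ≡⟨ cong (_∨ ¬ (∇ a)) (sym (¬¬ _)) ⟩
    ¬ (¬ (∇ a)) ∨ ¬ (∇ a)  ≡⟨ sym (deMorgan _ _) ⟩
    ¬ (¬ (∇ a) ∧ ∇ a)      ≡⟨ cong ¬_ (∇-compl a) ⟩
    ¬ 𝟘                    ≡⟨ ¬𝟘 ⟩
    𝟙                      ∎)

  -- ∇ kills the complement c′ of c, because it already kills x ∧ c′ = 𝟘 and is multiplicative.
  ∇-least : ∀ {x c c′} → x ≤ c → Complements c c′ → (∇ x) ≤ c
  ∇-least {x} {c} {c′} x≤c (c∧c′ , c∨c′) = begin
    ∇ x ∧ c                   ≡⟨ sym (∨-identity _) ⟩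
    (∇ x ∧ c) ∨ 𝟘             ≡⟨ cong ((∇ x ∧ c) ∨_) (sym ∇x∧c′) ⟩
    (∇ x ∧ c) ∨ (∇ x ∧ c′)    ≡⟨ sym (∧-distrib-∨ _ _ _) ⟩
    ∇ x ∧ (c ∨ c′)            ≡⟨ cong (∇ x ∧_) c∨c′ ⟩
    ∇ x ∧ 𝟙                   ≡⟨ ∧-identity _ ⟩
    ∇ x                       ∎
    where
    x∧c′ : x ∧ c′ ≡ 𝟘
    x∧c′ = begin
      x ∧ c′        ≡⟨ cong (_∧ c′) (sym x≤c) ⟩
      (x ∧ c) ∧ c′  ≡⟨ ∧-assoc _ _ _ ⟩
      x ∧ (c ∧ c′)  ≡⟨ cong (x ∧_) c∧c′ ⟩
      x ∧ 𝟘         ≡⟨ ∧-zeroʳ x ⟩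
      𝟘             ∎
    ∇x∧c′ : ∇ x ∧ c′ ≡ 𝟘
    ∇x∧c′ = begin
      ∇ x ∧ c′               ≡⟨ cong (∇ x ∧_) (trans (sym (∇-incr c′)) (∧-comm _ _)) ⟩
      ∇ x ∧ (∇ c′ ∧ c′)      ≡⟨ sym (∧-assoc _ _ _) ⟩
      (∇ x ∧ ∇ c′) ∧ c′      ≡⟨ cong (_∧ c′) (sym (∇-∧ x c′)) ⟩
      ∇ (x ∧ c′) ∧ c′        ≡⟨ cong (λ z → ∇ z ∧ c′) x∧c′ ⟩
      ∇ 𝟘 ∧ c′               ≡⟨ cong (_∧ c′) ∇𝟘 ⟩
      𝟘 ∧ c′                 ≡⟨ ∧-zeroˡ c′ ⟩
      𝟘                      ∎

  ∇-complemented-fixed : ∀ {c c′} → Complements c c′ → ∇ c ≡ c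
  ∇-complemented-fixed {c} compl = ≤-antisym (∇-least (≤-refl c) compl) (∇-incr c)

  ∇∇ : ∀ a → ∇ (∇ a) ≡ ∇ a
  ∇∇ a = ∇-complemented-fixed (∇-complemented a)

  ∇¬∇ : ∀ a → ∇ (¬ (∇ a)) ≡ ¬ (∇ a)
  ∇¬∇ a = ∇-complemented-fixed (complements-sym (∇-complemented a))

  ∇𝟙 : ∇ 𝟙 ≡ 𝟙
  ∇𝟙 = trans (sym (∧-identityˡ _)) (∇-incr 𝟙)

  ∇-∨ : ∀ a b → ∇ (a ∨ b) ≡ ∇ a ∨ ∇ b
  ∇-∨ a b = ≤-antisym
    (∇-least (∨-mono-≤ (∇-incr a) (∇-incr b)) (complements-∨ (∇-complemented a) (∇-complemented b)))
    (∨-least (∇-mono-≤ (x≤x∨y a b)) (∇-mono-≤ (y≤x∨y a b)))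

data NNF : Set where
  lit       : Literal → NNF
  _∧ₙ_ _∨ₙ_ : NNF → NNF → NNF
  ⊤ₙ ⊥ₙ     : NNF

¬Lit : Literal → Literal
¬Lit (pos , k)       = (neg , k)
¬Lit (neg , k)       = (pos , k)
¬Lit (nab , k)       = (negNab , k)
¬Lit (negNab , k)    = (nab , k)
¬Lit (nabNeg , k)    = (negNabNeg , k)
¬Lit (negNabNeg , k) = (nabNeg , k)

∇Lit : Literal → Literal
∇Lit (pos , k)       = (nab , k)
∇Lit (neg , k)       = (nabNeg , k)
∇Lit (nab , k)       = (nab , k)
∇Lit (nabNeg , k)    = (nabNeg , k)
∇Lit (negNab , k)    = (negNab , k)
∇Lit (negNabNeg , k) = (negNabNeg , k)

¬ₙ : NNF → NNF
¬ₙ (lit l)  = lit (¬Lit l)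
¬ₙ (t ∧ₙ u) = ¬ₙ t ∨ₙ ¬ₙ u
¬ₙ (t ∨ₙ u) = ¬ₙ t ∧ₙ ¬ₙ u
¬ₙ ⊤ₙ       = ⊥ₙ
¬ₙ ⊥ₙ       = ⊤ₙ

∇ₙ : NNF → NNF
∇ₙ (lit l)  = lit (∇Lit l)
∇ₙ (t ∧ₙ u) = ∇ₙ t ∧ₙ ∇ₙ u
∇ₙ (t ∨ₙ u) = ∇ₙ t ∨ₙ ∇ₙ u
∇ₙ ⊤ₙ       = ⊤ₙ
∇ₙ ⊥ₙ       = ⊥ₙ

nnf : Fm → NNF
nnf (var k)  = lit (pos , k)
nnf (φ ∧' ψ) = nnf φ ∧ₙ nnf ψ
nnf (φ ∨' ψ) = nnf φ ∨ₙ nnf ψ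
nnf (¬' φ)   = ¬ₙ (nnf φ)
nnf (∇' φ)   = ∇ₙ (nnf φ)
nnf ⊥'       = ⊥ₙ
nnf ⊤'       = ⊤ₙ

_∨ᶜ_ : CNF → CNF → CNF
[] ∨ᶜ d       = []
(cl ∷ c) ∨ᶜ d = map (cl ++_) d ++ (c ∨ᶜ d)

cnf : NNF → CNF
cnf (lit l)  = (l ∷ []) ∷ []
cnf (t ∧ₙ u) = cnf t ++ cnf u
cnf (t ∨ₙ u) = cnf t ∨ᶜ cnf u
cnf ⊤ₙ       = []
cnf ⊥ₙ       = [] ∷ []

module Semantics (A : ISAlgebra) (v : ℕ → ISAlgebra.Carrier A) where
  open ISAlgebra A
  open ISAlgebraProperties A
  open ≡-Reasoning

  ⟦_⟧ₗ : Literal → Carrier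
  ⟦ l ⟧ₗ = ⟦ A ⟧ (litFm l) v

  ⟦_⟧ₙ : NNF → Carrier
  ⟦ lit l ⟧ₙ  = ⟦ l ⟧ₗ
  ⟦ t ∧ₙ u ⟧ₙ = ⟦ t ⟧ₙ ∧ ⟦ u ⟧ₙ
  ⟦ t ∨ₙ u ⟧ₙ = ⟦ t ⟧ₙ ∨ ⟦ u ⟧ₙ
  ⟦ ⊤ₙ ⟧ₙ     = 𝟙
  ⟦ ⊥ₙ ⟧ₙ     = 𝟘

  ¬Lit-sound : ∀ l → ⟦ ¬Lit l ⟧ₗ ≡ ¬ ⟦ l ⟧ₗ
  ¬Lit-sound (pos , k)       = refl
  ¬Lit-sound (neg , k)       = sym (¬¬ _)
  ¬Lit-sound (nab , k)       = refl
  ¬Lit-sound (negNab , k)    = sym (¬¬ _)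
  ¬Lit-sound (nabNeg , k)    = refl
  ¬Lit-sound (negNabNeg , k) = sym (¬¬ _)

  ∇Lit-sound : ∀ l → ⟦ ∇Lit l ⟧ₗ ≡ ∇ ⟦ l ⟧ₗ
  ∇Lit-sound (pos , k)       = refl
  ∇Lit-sound (neg , k)       = refl
  ∇Lit-sound (nab , k)       = sym (∇∇ _)
  ∇Lit-sound (nabNeg , k)    = sym (∇∇ _)
  ∇Lit-sound (negNab , k)    = sym (∇¬∇ _)
  ∇Lit-sound (negNabNeg , k) = sym (∇¬∇ _)

  ¬ₙ-sound : ∀ t → ⟦ ¬ₙ t ⟧ₙ ≡ ¬ ⟦ t ⟧ₙ
  ¬ₙ-sound (lit l)  = ¬Lit-sound l
  ¬ₙ-sound (t ∧ₙ u) = trans (cong₂ _∨_ (¬ₙ-sound t) (¬ₙ-sound u)) (sym (deMorgan _ _))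
  ¬ₙ-sound (t ∨ₙ u) = trans (cong₂ _∧_ (¬ₙ-sound t) (¬ₙ-sound u)) (sym (¬-∨ _ _))
  ¬ₙ-sound ⊤ₙ       = sym ¬𝟙
  ¬ₙ-sound ⊥ₙ       = sym ¬𝟘

  ∇ₙ-sound : ∀ t → ⟦ ∇ₙ t ⟧ₙ ≡ ∇ ⟦ t ⟧ₙ
  ∇ₙ-sound (lit l)  = ∇Lit-sound l
  ∇ₙ-sound (t ∧ₙ u) = trans (cong₂ _∧_ (∇ₙ-sound t) (∇ₙ-sound u)) (sym (∇-∧ _ _))
  ∇ₙ-sound (t ∨ₙ u) = trans (cong₂ _∨_ (∇ₙ-sound t) (∇ₙ-sound u)) (sym (∇-∨ _ _))
  ∇ₙ-sound ⊤ₙ       = sym ∇𝟙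
  ∇ₙ-sound ⊥ₙ       = sym ∇𝟘

  nnf-sound : ∀ φ → ⟦ nnf φ ⟧ₙ ≡ ⟦ A ⟧ φ v
  nnf-sound (var k)  = refl
  nnf-sound (φ ∧' ψ) = cong₂ _∧_ (nnf-sound φ) (nnf-sound ψ)
  nnf-sound (φ ∨' ψ) = cong₂ _∨_ (nnf-sound φ) (nnf-sound ψ)
  nnf-sound (¬' φ)   = trans (¬ₙ-sound (nnf φ)) (cong ¬_ (nnf-sound φ))
  nnf-sound (∇' φ)   = trans (∇ₙ-sound (nnf φ)) (cong ∇_ (nnf-sound φ))
  nnf-sound ⊥'       = refl
  nnf-sound ⊤'       = refl

  ⟦_⟧ᶜˡ : List Literal → Carrier
  ⟦ [] ⟧ᶜˡ     = 𝟘
  ⟦ l ∷ ls ⟧ᶜˡ = ⟦ l ⟧ₗ ∨ ⟦ ls ⟧ᶜˡ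

  ⟦_⟧ᶜ : CNF → Carrier
  ⟦ [] ⟧ᶜ      = 𝟙
  ⟦ cl ∷ c ⟧ᶜ  = ⟦ cl ⟧ᶜˡ ∧ ⟦ c ⟧ᶜ

  ⋁-clause : ∀ cl → ⟦ A ⟧ (⋁ (map litFm cl)) v ≡ ⟦ cl ⟧ᶜˡ
  ⋁-clause []            = refl
  ⋁-clause (l ∷ [])      = sym (∨-identity _)
  ⋁-clause (l ∷ l′ ∷ ls) = cong (⟦ l ⟧ₗ ∨_) (⋁-clause (l′ ∷ ls))

  cnfFm-sound : ∀ c → ⟦ A ⟧ (cnfFm c) v ≡ ⟦ c ⟧ᶜ
  cnfFm-sound []              = refl
  cnfFm-sound (cl ∷ [])       = trans (⋁-clause cl) (sym (∧-identity _))
  cnfFm-sound (cl ∷ cl′ ∷ c)  = cong₂ _∧_ (⋁-clause cl) (cnfFm-sound (cl′ ∷ c))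

  ⟦++⟧ᶜˡ : ∀ a b → ⟦ a ++ b ⟧ᶜˡ ≡ ⟦ a ⟧ᶜˡ ∨ ⟦ b ⟧ᶜˡ
  ⟦++⟧ᶜˡ [] b      = sym (∨-identityˡ _)
  ⟦++⟧ᶜˡ (l ∷ a) b = trans (cong (⟦ l ⟧ₗ ∨_) (⟦++⟧ᶜˡ a b)) (sym (∨-assoc _ _ _))

  ⟦++⟧ᶜ : ∀ c d → ⟦ c ++ d ⟧ᶜ ≡ ⟦ c ⟧ᶜ ∧ ⟦ d ⟧ᶜ
  ⟦++⟧ᶜ [] d        = sym (∧-identityˡ _)
  ⟦++⟧ᶜ (cl ∷ c) d  = trans (cong (⟦ cl ⟧ᶜˡ ∧_) (⟦++⟧ᶜ c d)) (sym (∧-assoc _ _ _))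

  ⟦map-++⟧ᶜ : ∀ cl d → ⟦ map (cl ++_) d ⟧ᶜ ≡ ⟦ cl ⟧ᶜˡ ∨ ⟦ d ⟧ᶜ
  ⟦map-++⟧ᶜ cl []      = sym (∨-zeroʳ _)
  ⟦map-++⟧ᶜ cl (e ∷ d) = begin
    ⟦ cl ++ e ⟧ᶜˡ ∧ ⟦ map (cl ++_) d ⟧ᶜ        ≡⟨ cong₂ _∧_ (⟦++⟧ᶜˡ cl e) (⟦map-++⟧ᶜ cl d) ⟩
    (⟦ cl ⟧ᶜˡ ∨ ⟦ e ⟧ᶜˡ) ∧ (⟦ cl ⟧ᶜˡ ∨ ⟦ d ⟧ᶜ)  ≡⟨ sym (∨-distrib-∧ _ _ _) ⟩
    ⟦ cl ⟧ᶜˡ ∨ (⟦ e ⟧ᶜˡ ∧ ⟦ d ⟧ᶜ)              ∎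

  ⟦∨ᶜ⟧ : ∀ c d → ⟦ c ∨ᶜ d ⟧ᶜ ≡ ⟦ c ⟧ᶜ ∨ ⟦ d ⟧ᶜ
  ⟦∨ᶜ⟧ [] d       = sym (∨-zeroˡ _)
  ⟦∨ᶜ⟧ (cl ∷ c) d = begin
    ⟦ map (cl ++_) d ++ (c ∨ᶜ d) ⟧ᶜ          ≡⟨ ⟦++⟧ᶜ (map (cl ++_) d) (c ∨ᶜ d) ⟩
    ⟦ map (cl ++_) d ⟧ᶜ ∧ ⟦ c ∨ᶜ d ⟧ᶜ        ≡⟨ cong₂ _∧_ (⟦map-++⟧ᶜ cl d) (⟦∨ᶜ⟧ c d) ⟩
    (⟦ cl ⟧ᶜˡ ∨ D) ∧ (⟦ c ⟧ᶜ ∨ D)            ≡⟨ cong₂ _∧_ (∨-comm _ _) (∨-comm _ _) ⟩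
    (D ∨ ⟦ cl ⟧ᶜˡ) ∧ (D ∨ ⟦ c ⟧ᶜ)            ≡⟨ sym (∨-distrib-∧ _ _ _) ⟩
    D ∨ (⟦ cl ⟧ᶜˡ ∧ ⟦ c ⟧ᶜ)                  ≡⟨ ∨-comm _ _ ⟩
    (⟦ cl ⟧ᶜˡ ∧ ⟦ c ⟧ᶜ) ∨ D                  ∎
    where D = ⟦ d ⟧ᶜ

  cnf-sound : ∀ t → ⟦ cnf t ⟧ᶜ ≡ ⟦ t ⟧ₙ
  cnf-sound (lit l)  = trans (∧-identity _) (∨-identity _)
  cnf-sound (t ∧ₙ u) = trans (⟦++⟧ᶜ (cnf t) (cnf u)) (cong₂ _∧_ (cnf-sound t) (cnf-sound u))
  cnf-sound (t ∨ₙ u) = trans (⟦∨ᶜ⟧ (cnf t) (cnf u)) (cong₂ _∨_ (cnf-sound t) (cnf-sound u))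
  cnf-sound ⊤ₙ       = refl
  cnf-sound ⊥ₙ       = ∧-identity 𝟘

  normalForm-sound : ∀ φ → ⟦ A ⟧ φ v ≡ ⟦ A ⟧ (cnfFm (cnf (nnf φ))) v
  normalForm-sound φ = begin
    ⟦ A ⟧ φ v                    ≡⟨ sym (nnf-sound φ) ⟩
    ⟦ nnf φ ⟧ₙ                   ≡⟨ sym (cnf-sound (nnf φ)) ⟩
    ⟦ cnf (nnf φ) ⟧ᶜ             ≡⟨ sym (cnfFm-sound (cnf (nnf φ))) ⟩
    ⟦ A ⟧ (cnfFm (cnf (nnf φ))) v ∎

≡Six-from-⟦⟧ : ∀ β γ → (∀ A v → ⟦ A ⟧ β v ≡ ⟦ A ⟧ γ v) → β ≡Six γ
≡Six-from-⟦⟧ β γ same =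
    (λ A v a a≤β → subst (ISAlgebra._≤_ A a) (same A v) a≤β)
  , (λ A v a a≤γ → subst (ISAlgebra._≤_ A a) (sym (same A v)) a≤γ)

-- ⊤ and ⊥ are themselves CNFs (no clauses, one empty clause), so the third alternative always holds.
mainTheorem15 : (α : Fm) →
    (α ≡Six ⊤') ⊎ (α ≡Six ⊥') ⊎ ∃ (λ (c : CNF) → α ≡Six cnfFm c)
mainTheorem15 α = inj₂ (inj₂ (cnf (nnf α) , ≡Six-from-⟦⟧ α (cnfFm (cnf (nnf α))) normalForm))
  where
  normalForm : ∀ A v → ⟦ A ⟧ α v ≡ ⟦ A ⟧ (cnfFm (cnf (nnf α))) v
  normalForm A v = Semantics.normalForm-sound A v α
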